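{- Let $\mathcal{A}$ be a class of square arrays satisfying properties (i) and (ii) below, let $\frac12\le\alpha\le1$, and suppose $\mathcal{M}_{\mathcal{A}}(\alpha)$ is non-empty. Let $A\in\mathcal{M}^*_{\mathcal{A}}(\alpha)$ have order $n$. If $A_{ij}$ is a singleton, then $|\Psi_{ij}(A)|>\alpha(2n-1)$, and $R_i(A)$ contains more than $(2\alpha-1)n$ symbols that appear only in row $i$ of $A$, and $C_j(A)$ contains more than $(2\alpha-1)n$ symbols that appear only in column $j$ of $A$.
   Context: An array of order $n$ is an $n\times n$ array of symbols, $A_{ij}$ being the symbol in cell $(i,j)$. A transversal of an $n\times n$ array is a set of $n$ cells in distinct rows and distinct columns containing $n$ distinct symbols. A symbol is a singleton if it occurs exactly once in $A$, and a clone otherwise. $R_i(A)$, $C_j(A)$ are the sets of symbols in row $i$, column $j$. $A(i\mid j)$ is the array obtained by deleting row $i$ and column $j$; $\Psi_{ij}(A)$ is the set of symbols that appear in $A$ but not in $A(i\mid j)$. The class $\mathcal{A}$ satisfies: (i) deleting any row and any column from an array in $\mathcal{A}$ gives an array in $\mathcal{A}$; (ii) changing the symbol in one cell of an array in $\mathcal{A}$ to a new symbol appearing nowhere else in the array gives an array in $\mathcal{A}$. $\mathcal{M}_{\mathcal{A}}(\alpha)$ is the set of arrays in $\mathcal{A}$ with no transversal whose number of distinct symbols is at least $\alpha$ times the number of cells. $\mathcal{M}^*_{\mathcal{A}}(\alpha)$ is the set of $A\in\mathcal{M}_{\mathcal{A}}(\alpha)$ such that no array in $\mathcal{M}_{\mathcal{A}}(\alpha)$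 has smaller order than $A$, and no array in $\mathcal{M}_{\mathcal{A}}(\alpha)$ of the same order as $A$ has more distinct symbols than $A$.
   Formalization: The parameter α, with $\frac12\le\alpha\le1$, is taken to be rational. -}

module Defs where

open import Data.Nat as ℕ using (ℕ; suc; _≟_)
open import Data.Fin using (Fin; punchIn)
import Data.Fin as Fin
open import Data.Integer using (+_)
open import Data.Rational as ℚ using (ℚ; _/_)
open import Data.List using (List; []; _∷_; length; filter; deduplicate; concatMap; map; allFin)
open import Data.List.Membership.DecPropositional _≟_ using (_∈?_; _∉_)
open import Data.Product using (Σ; _×_)
open import Data.Bool using (if_then_else_)
open import Relation.Nullary using (¬_; ¬?; does)
open import Relation.Nullary.Decidable using (_×-dec_)
open import Relation.Binary.PropositionalEquality using (_≡_; _≢_)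
open import Function.Definitions using (Injective)

-- Symbols are natural numbers (an unlimited supply of symbols).
Symbol : Set
Symbol = ℕ

Array : ℕ → Set
Array n = Fin n → Fin n → Symbol

⟦_⟧ : ℕ → ℚ
⟦ k ⟧ = + k / 1

cells : (n : ℕ) → List (Fin n × Fin n)
cells n = concatMap (λ r → map (λ c → (r Data.Product., c)) (allFin n)) (allFin n)
  where import Data.Product

entries : ∀ {n} → Array n → List Symbol
entries {n} A = map (λ rc → A (Data.Product.proj₁ rc) (Data.Product.proj₂ rc)) (cells n)
  where import Data.Product

distinct : List Symbol → List Symbol
distinct = deduplicate _≟_

#sym : ∀ {n} → Array n → ℕ
#sym A = length (distinct (entries A))

occ : ∀ {n} → Array n → Symbol → ℕ
occ A s = length (filter (_≟ s) (entries A))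

Singleton : ∀ {n} → Array n → Fin n → Fin n → Set
Singleton A i j = occ A (A i j) ≡ 1

del : ∀ {n} → Array (suc n) → Fin (suc n) → Fin (suc n) → Array n
del A i j r c = A (punchIn i r) (punchIn j c)

update : ∀ {n} → Array n → Fin n → Fin n → Symbol → Array n
update A i j s r c = if does ((r Fin.≟ i) ×-dec (c Fin.≟ j)) then s else A r c

-- a transversal: n cells in distinct rows and distinct columns (row r ↦ column σ r)
-- containing n distinct symbols
HasTransversal : ∀ n → Array n → Set
HasTransversal n A = Σ (Fin n → Fin n) λ σ → Injective _≡_ _≡_ σ × Injective _≡_ _≡_ (λ r → A r (σ r))

Class : Set₁
Class = (n : ℕ) → Array n → Set

Prop-i : Class → Set
Prop-i 𝒜 = ∀ n (A : Array (suc n)) → 𝒜 (suc n) A → ∀ i j → 𝒜 n (del A i j)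

Prop-ii : Class → Set
Prop-ii 𝒜 = ∀ n (A : Array n) → 𝒜 n A → ∀ i j (s : Symbol) →
  (∀ r c → ¬ (r ≡ i × c ≡ j) → A r c ≢ s) → 𝒜 n (update A i j s)

InM : Class → ℚ → ∀ n → Array n → Set
InM 𝒜 α n A = 𝒜 n A × ¬ HasTransversal n A × (α ℚ.* ⟦ n ℕ.* n ⟧ ℚ.≤ ⟦ #sym A ⟧)

InM* : Class → ℚ → ∀ n → Array n → Set
InM* 𝒜 α n A = InM 𝒜 α n A
  × (∀ m (B : Array m) → InM 𝒜 α m B → n ℕ.≤ m)
  × (∀ (B : Array n) → InM 𝒜 α n B → #sym B ℕ.≤ #sym A)

Ψ : ∀ {n} → Array (suc n) → Fin (suc n) → Fin (suc n) → List Symbol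
Ψ A i j = filter (λ s → ¬? (s ∈? entries (del A i j))) (distinct (entries A))

entriesOutsideRow : ∀ {n} → Array n → Fin n → List Symbol
entriesOutsideRow {n} A i =
  map (λ rc → A (Data.Product.proj₁ rc) (Data.Product.proj₂ rc))
      (filter (λ rc → ¬? (Data.Product.proj₁ rc Fin.≟ i)) (cells n))
  where import Data.Product

entriesOutsideCol : ∀ {n} → Array n → Fin n → List Symbol
entriesOutsideCol {n} A j =
  map (λ rc → A (Data.Product.proj₁ rc) (Data.Product.proj₂ rc))
      (filter (λ rc → ¬? (Data.Product.proj₂ rc Fin.≟ j)) (cells n))
  where import Data.Product

rowEntries : ∀ {n} → Array n → Fin n → List Symbol
rowEntries {n} A i = map (λ c → A i c) (allFin n)

colEntries : ∀ {n} → Array n → Fin n → List Symbol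
colEntries {n} A j = map (λ r → A r j) (allFin n)

onlyInRow : ∀ {n} → Array n → Fin n → List Symbol
onlyInRow A i = filter (λ s → ¬? (s ∈? entriesOutsideRow A i)) (distinct (rowEntries A i))

onlyInCol : ∀ {n} → Array n → Fin n → List Symbol
onlyInCol A j = filter (λ s → ¬? (s ∈? entriesOutsideCol A j)) (distinct (colEntries A j))

-- Deleting the row and column of a singleton cell (i , j) of A leaves an array of 𝒜 without a
-- transversal, since any transversal of it extends through the singleton. By minimality of the
-- order it therefore has fewer than α n² symbols, while A has at least α (n+1)² of them, so more
-- than α (2n+1) symbols vanish. Each vanishing symbol lies only in row i or else in column j
-- outside row i; the latter holds at most n symbols, which (as α ≤ 1) gives the row bound, and
-- the column bound follows by transposing.

{-# OPTIONS --safe #-}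
module Submission where

open import Defs
open import Data.Nat using (ℕ; suc)
open import Data.Fin using (Fin)
open import Data.Rational using (ℚ; ½; 1ℚ; _≤_; _<_; _*_; _-_)
open import Data.List using (length)
open import Data.Product using (Σ; _×_)

import Data.Nat as ℕ
import Data.Nat.Properties as ℕ
import Data.Nat.Coprimality as Coprimality
open import Data.Integer as ℤ using (+_)
import Data.Integer.Properties as ℤ
open import Data.Rational using (mkℚ; _+_; -_)
import Data.Rational as ℚ
import Data.Rational.Properties as ℚ
open import Data.Rational.Solver using (module +-*-Solver)
open +-*-Solver using (solve; _:=_; _:+_; _:*_; _:-_; :-_; con)
open import Data.Fin as Fin using (punchIn; punchOut)
import Data.Fin.Properties as Fin
open import Data.List using (List; []; _∷_; _++_; map; filter; allFin)
import Data.List.Properties as List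
open import Data.List.Membership.Propositional using (_∈_; _∉_)
open import Data.List.Membership.Propositional.Properties
open import Data.List.Membership.DecPropositional ℕ._≟_ using (_∈?_)
open import Data.List.Relation.Binary.Subset.Propositional using (_⊆_)
open import Data.List.Relation.Binary.Subset.Propositional.Properties using (++⁺)
import Data.List.Relation.Unary.All as All
open import Data.List.Relation.Unary.Any as Any using (here; there)
open import Data.List.Relation.Unary.AllPairs using (_∷_)
open import Data.List.Relation.Unary.Unique.Propositional using (Unique)
import Data.List.Relation.Unary.Unique.Propositional.Properties as Unique
open import Data.List.Relation.Unary.Unique.DecPropositional.Properties using (deduplicate-!)
open import Data.Product using (_,_; proj₁; proj₂; ∃₂)
open import Data.Sum using (_⊎_; inj₁; inj₂)
open import Data.Bool using (true; false)
open import Function using (_∘_; id)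
open import Function.Definitions using (Injective)
open import Relation.Nullary using (¬?; yes; no; does; contradiction)
open import Relation.Unary using (Decidable)
open import Relation.Binary.Definitions using (DecidableEquality)
open import Relation.Binary.PropositionalEquality

unique∧⊆⇒length≤ : ∀ {A : Set} → DecidableEquality A → ∀ {xs ys : List A} →
                   Unique xs → xs ⊆ ys → length xs ℕ.≤ length ys
unique∧⊆⇒length≤ _≟_ {[]}     _            _     = ℕ.z≤n
unique∧⊆⇒length≤ _≟_ {x ∷ xs} {ys} (x∉xs ∷ xs!) xs⊆ys =
  ℕ.≤-trans (ℕ.s≤s (unique∧⊆⇒length≤ _≟_ xs! xs⊆ys-x))
            (List.filter-notAll ≢x? ys (Any.map (λ x≡y x≢y → x≢y x≡y) (xs⊆ys (here refl))))
  where
  ≢x? = λ y → ¬? (x ≟ y)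
  xs⊆ys-x : xs ⊆ filter ≢x? ys
  xs⊆ys-x y∈xs = ∈-filter⁺ ≢x? (xs⊆ys (there y∈xs)) (All.lookup x∉xs y∈xs)

unique∧⊆++⇒length≤ : ∀ {A : Set} → DecidableEquality A → ∀ {xs} ys {zs : List A} →
                     Unique xs → xs ⊆ ys ++ zs → length xs ℕ.≤ length ys ℕ.+ length zs
unique∧⊆++⇒length≤ _≟_ ys xs! xs⊆ys++zs =
  subst (_ ℕ.≤_) (List.length-++ ys) (unique∧⊆⇒length≤ _≟_ xs! xs⊆ys++zs)

≢-members⇒2≤length : ∀ {A : Set} {x y : A} {xs} → x ≢ y → x ∈ xs → y ∈ xs → 2 ℕ.≤ length xs
≢-members⇒2≤length {xs = _ ∷ []}    x≢y (here refl) (here refl) = contradiction refl x≢y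
≢-members⇒2≤length {xs = _ ∷ _ ∷ _} _   _           _           = ℕ.s≤s (ℕ.s≤s ℕ.z≤n)

length-filter-map : ∀ {A B : Set} {P : B → Set} (P? : Decidable P) (f : A → B) xs →
                    length (filter P? (map f xs)) ≡ length (filter (P? ∘ f) xs)
length-filter-map P? f []       = refl
length-filter-map P? f (x ∷ xs) with does (P? (f x))
... | true  = cong suc (length-filter-map P? f xs)
... | false = length-filter-map P? f xs

length-distinct≤ : ∀ xs ys →
  length (distinct xs) ℕ.≤ length (distinct ys) ℕ.+ length (filter (λ s → ¬? (s ∈? ys)) (distinct xs))
length-distinct≤ xs ys = unique∧⊆++⇒length≤ ℕ._≟_ (distinct ys) (deduplicate-! ℕ._≟_ xs) split
  where
  split : distinct xs ⊆ distinct ys ++ filter (λ s → ¬? (s ∈? ys)) (distinct xs)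
  split {s} s∈xs with s ∈? ys
  ... | yes s∈ys = ∈-++⁺ˡ (∈-deduplicate⁺ ℕ._≟_ s∈ys)
  ... | no  s∉ys = ∈-++⁺ʳ (distinct ys) (∈-filter⁺ (λ s → ¬? (s ∈? ys)) s∈xs s∉ys)

⟦⟧≡mkℚ : ∀ k → ⟦ k ⟧ ≡ mkℚ (+ k) 0 (Coprimality.sym (Coprimality.1-coprimeTo k))
⟦⟧≡mkℚ k = ℚ.normalize-coprime _

⟦⟧-+ : ∀ a b → ⟦ a ℕ.+ b ⟧ ≡ ⟦ a ⟧ + ⟦ b ⟧
⟦⟧-+ a b = begin
  ⟦ a ℕ.+ b ⟧                         ≡⟨ ℚ./-cong +[a+b]≡ refl ⟩
  (+ a ℤ.* + 1 ℤ.+ + b ℤ.* + 1) ℚ./ 1 ≡⟨ cong₂ _+_ (⟦⟧≡mkℚ a) (⟦⟧≡mkℚ b) ⟨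
  ⟦ a ⟧ + ⟦ b ⟧                       ∎
  where
  open ≡-Reasoning
  +[a+b]≡ = sym (cong₂ ℤ._+_ (ℤ.*-identityʳ (+ a)) (ℤ.*-identityʳ (+ b)))

⟦⟧-* : ∀ a b → ⟦ a ℕ.* b ⟧ ≡ ⟦ a ⟧ * ⟦ b ⟧
⟦⟧-* a b = begin
  ⟦ a ℕ.* b ⟧         ≡⟨ ℚ./-cong (ℤ.pos-* a b) refl ⟩
  (+ a ℤ.* + b) ℚ./ 1 ≡⟨ cong₂ _*_ (⟦⟧≡mkℚ a) (⟦⟧≡mkℚ b) ⟨
  ⟦ a ⟧ * ⟦ b ⟧       ∎
  where open ≡-Reasoning

⟦⟧-mono-≤ : ∀ {a b} → a ℕ.≤ b → ⟦ a ⟧ ≤ ⟦ b ⟧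
⟦⟧-mono-≤ {a} {b} a≤b rewrite ⟦⟧≡mkℚ a | ⟦⟧≡mkℚ b = ℚ.*≤* (ℤ.*-monoʳ-≤-nonNeg (+ 1) (ℤ.+≤+ a≤b))

+-cancelˡ-< : ∀ r {p q} → r + p < r + q → p < q
+-cancelˡ-< r {p} {q} r+p<r+q = subst₂ _<_ (cancel p) (cancel q) (ℚ.+-monoʳ-< (- r) r+p<r+q)
  where
  cancel : ∀ x → - r + (r + x) ≡ x
  cancel x = solve 2 (λ r x → :- r :+ (r :+ x) := x) refl r x

square-step : ∀ α n → α * ⟦ suc n ℕ.* suc n ⟧ ≡ α * ⟦ n ℕ.* n ⟧ + α * (⟦ 2 ℕ.* suc n ⟧ - 1ℚ)
square-step α n rewrite ⟦⟧-* (suc n) (suc n) | ⟦⟧-* 2 (suc n) | ⟦⟧-* n n | ⟦⟧-+ 1 n =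
  solve 2 (λ α x → α :* ((con 1ℚ :+ x) :* (con 1ℚ :+ x))
                   := α :* (x :* x) :+ α :* ((con 1ℚ :+ con 1ℚ) :* (con 1ℚ :+ x) :- con 1ℚ)) refl α ⟦ n ⟧

line-step : ∀ α n → ⟦ suc n ⟧ + (⟦ 2 ⟧ * α - 1ℚ) * ⟦ suc n ⟧ ≡ α + α * (⟦ 2 ℕ.* suc n ⟧ - 1ℚ)
line-step α n rewrite ⟦⟧-* 2 (suc n) =
  solve 2 (λ α x → x :+ ((con 1ℚ :+ con 1ℚ) :* α :- con 1ℚ) :* x
                   := α :+ α :* ((con 1ℚ :+ con 1ℚ) :* x :- con 1ℚ)) refl α ⟦ suc n ⟧

square-gap : ∀ α n {S S′ p} → α * ⟦ suc n ℕ.* suc n ⟧ ≤ ⟦ S ⟧ → ⟦ S′ ⟧ < α * ⟦ n ℕ.* n ⟧ →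
             S ℕ.≤ S′ ℕ.+ p → α * (⟦ 2 ℕ.* suc n ⟧ - 1ℚ) < ⟦ p ⟧
square-gap α n {S} {S′} {p} dense sparse S≤S′+p = +-cancelˡ-< (α * ⟦ n ℕ.* n ⟧) (begin-strict
  α * ⟦ n ℕ.* n ⟧ + α * (⟦ 2 ℕ.* suc n ⟧ - 1ℚ) ≡⟨ square-step α n ⟨
  α * ⟦ suc n ℕ.* suc n ⟧                     ≤⟨ dense ⟩
  ⟦ S ⟧                                       ≤⟨ ⟦⟧-mono-≤ S≤S′+p ⟩
  ⟦ S′ ℕ.+ p ⟧                                ≡⟨ ⟦⟧-+ S′ p ⟩
  ⟦ S′ ⟧ + ⟦ p ⟧                              <⟨ ℚ.+-monoˡ-< ⟦ p ⟧ sparse ⟩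
  α * ⟦ n ℕ.* n ⟧ + ⟦ p ⟧                     ∎)
  where open ℚ.≤-Reasoning

line-gap : ∀ α n {p r} → α ≤ 1ℚ → α * (⟦ 2 ℕ.* suc n ⟧ - 1ℚ) < ⟦ p ⟧ → p ℕ.≤ r ℕ.+ n →
           (⟦ 2 ⟧ * α - 1ℚ) * ⟦ suc n ⟧ < ⟦ r ⟧
line-gap α n {p} {r} α≤1 gap p≤r+n = +-cancelˡ-< ⟦ suc n ⟧ (begin-strict
  ⟦ suc n ⟧ + (⟦ 2 ⟧ * α - 1ℚ) * ⟦ suc n ⟧ ≡⟨ line-step α n ⟩
  α + α * (⟦ 2 ℕ.* suc n ⟧ - 1ℚ)           ≤⟨ ℚ.+-monoˡ-≤ _ α≤1 ⟩
  1ℚ + α * (⟦ 2 ℕ.* suc n ⟧ - 1ℚ)          <⟨ ℚ.+-monoʳ-< 1ℚ gap ⟩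
  1ℚ + ⟦ p ⟧                               ≡⟨ ⟦⟧-+ 1 p ⟨
  ⟦ suc p ⟧                                ≤⟨ ⟦⟧-mono-≤ (ℕ.s≤s (subst (p ℕ.≤_) (ℕ.+-comm r n) p≤r+n)) ⟩
  ⟦ suc n ℕ.+ r ⟧                          ≡⟨ ⟦⟧-+ (suc n) r ⟩
  ⟦ suc n ⟧ + ⟦ r ⟧                        ∎)
  where open ℚ.≤-Reasoning

transpose : ∀ {n} → Array n → Array n
transpose A r c = A c r

colEntriesOutsideRow : ∀ {n} → Array (suc n) → Fin (suc n) → Fin (suc n) → List Symbol
colEntriesOutsideRow {n} A i j = map (λ r → A (punchIn i r) j) (allFin n)

length-colEntriesOutsideRow : ∀ {n} (A : Array (suc n)) i j → length (colEntriesOutsideRow A i j) ≡ n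
length-colEntriesOutsideRow {n} A i j = trans (List.length-map _ (allFin n)) (List.length-tabulate id)

module _ {n : ℕ} where

  entryAt : Array n → Fin n × Fin n → Symbol
  entryAt A rc = A (proj₁ rc) (proj₂ rc)

  ∈-cells : (r c : Fin n) → (r , c) ∈ cells n
  ∈-cells r c = ∈-concatMap⁺ (λ r′ → map (r′ ,_) (allFin n))
                  (Any.map (λ { refl → ∈-map⁺ (r ,_) (∈-allFin c) }) (∈-allFin r))

  ∈-entries⁺ : (A : Array n) (r c : Fin n) → A r c ∈ entries A
  ∈-entries⁺ A r c = ∈-map⁺ (entryAt A) (∈-cells r c)

  ∈-entries⁻ : ∀ {A : Array n} {s} → s ∈ entries A → ∃₂ λ r c → s ≡ A r c
  ∈-entries⁻ s∈A with (r , c) , _ , s≡Arc ← ∈-map⁻ _ s∈A = r , c , s≡Arc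

  ∈-entries-transpose : ∀ {A : Array n} {s} → s ∈ entries A → s ∈ entries (transpose A)
  ∈-entries-transpose s∈A with r , c , refl ← ∈-entries⁻ s∈A = ∈-entries⁺ (transpose _) c r

  ∈-entriesOutsideRow⁺ : ∀ (A : Array n) {i r} c → r ≢ i → A r c ∈ entriesOutsideRow A i
  ∈-entriesOutsideRow⁺ A {i} {r} c r≢i =
    ∈-map∘filter⁺ (entryAt A) (λ rc → ¬? (proj₁ rc Fin.≟ i)) ((r , c) , ∈-cells r c , refl , r≢i)

  ∈-entriesOutsideRow⁻ : ∀ {A : Array n} {i s} → s ∈ entriesOutsideRow A i → ∃₂ λ r c → r ≢ i × s ≡ A r c
  ∈-entriesOutsideRow⁻ {A} {i} s∈
    with (r , c) , _ , s≡Arc , r≢i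
           ← ∈-map∘filter⁻ (entryAt A) (λ rc → ¬? (proj₁ rc Fin.≟ i)) {xs = cells n} s∈
    = r , c , r≢i , s≡Arc

  entriesOutsideCol⇒entriesOutsideRowᵀ : ∀ {A : Array n} {j s} →
    s ∈ entriesOutsideCol A j → s ∈ entriesOutsideRow (transpose A) j
  entriesOutsideCol⇒entriesOutsideRowᵀ {A} {j} s∈
    with (r , c) , _ , refl , c≢j
           ← ∈-map∘filter⁻ (entryAt A) (λ rc → ¬? (proj₂ rc Fin.≟ j)) {xs = cells n} s∈
    = ∈-entriesOutsideRow⁺ (transpose A) r c≢j

  onlyInRowᵀ⇒onlyInCol : ∀ {A : Array n} {j s} → s ∈ onlyInRow (transpose A) j → s ∈ onlyInCol A j
  onlyInRowᵀ⇒onlyInCol {A} {j} s∈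
    with s∈col , s∉rest ← ∈-filter⁻ _ {xs = distinct (colEntries A j)} s∈
    = ∈-filter⁺ (λ s → ¬? (s ∈? entriesOutsideCol A j)) s∈col
                (s∉rest ∘ entriesOutsideCol⇒entriesOutsideRowᵀ)

  ∉entriesOutsideRow⇒∈rowEntries : ∀ {A : Array n} {i s} →
    s ∈ entries A → s ∉ entriesOutsideRow A i → s ∈ rowEntries A i
  ∉entriesOutsideRow⇒∈rowEntries {A} {i} s∈A s∉ with r , c , refl ← ∈-entries⁻ s∈A with r Fin.≟ i
  ... | yes refl = ∈-map⁺ (A i) (∈-allFin c)
  ... | no r≢i   = contradiction (∈-entriesOutsideRow⁺ A c r≢i) s∉

module _ {n : ℕ} (A : Array (suc n)) (i j : Fin (suc n)) where

  ∈-colEntriesOutsideRow⁺ : ∀ {r} → r ≢ i → A r j ∈ colEntriesOutsideRow A i j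
  ∈-colEntriesOutsideRow⁺ r≢i =
    subst (_∈ colEntriesOutsideRow A i j) (cong (λ r → A r j) (Fin.punchIn-punchOut (r≢i ∘ sym)))
      (∈-map⁺ (λ r → A (punchIn i r) j) (∈-allFin _))

  ∈-Ψ⁻ : ∀ {s} → s ∈ Ψ A i j → s ∈ entries A × s ∉ entries (del A i j)
  ∈-Ψ⁻ s∈ with s∈A , s∉A′ ← ∈-filter⁻ (λ s → ¬? (s ∈? entries (del A i j))) {xs = distinct (entries A)} s∈
    = ∈-deduplicate⁻ ℕ._≟_ _ s∈A , s∉A′

  ∈-Ψ⁺ : ∀ {s} → s ∈ entries A → s ∉ entries (del A i j) → s ∈ Ψ A i j
  ∈-Ψ⁺ s∈A = ∈-filter⁺ (λ s → ¬? (s ∈? entries (del A i j))) (∈-deduplicate⁺ ℕ._≟_ s∈A)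

  Ψ-unique : Unique (Ψ A i j)
  Ψ-unique = Unique.filter⁺ (λ s → ¬? (s ∈? entries (del A i j))) (deduplicate-! ℕ._≟_ (entries A))

  ∉del⇒onRow⊎onCol : ∀ {r c} → A r c ∉ entries (del A i j) → r ≡ i ⊎ c ≡ j
  ∉del⇒onRow⊎onCol {r} {c} Arc∉ with r Fin.≟ i | c Fin.≟ j
  ... | yes r≡i | _       = inj₁ r≡i
  ... | no _    | yes c≡j = inj₂ c≡j
  ... | no r≢i  | no c≢j  =
    contradiction (subst (_∈ entries (del A i j)) Arc≡ (∈-entries⁺ (del A i j) _ _)) Arc∉
    where Arc≡ = cong₂ A (Fin.punchIn-punchOut (r≢i ∘ sym)) (Fin.punchIn-punchOut (c≢j ∘ sym))

  Ψ⊆onlyInRow++col : Ψ A i j ⊆ onlyInRow A i ++ colEntriesOutsideRow A i j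
  Ψ⊆onlyInRow++col {s} s∈ with s∈A , s∉A′ ← ∈-Ψ⁻ s∈ with s ∈? entriesOutsideRow A i
  ... | no s∉rest = ∈-++⁺ˡ (∈-filter⁺ (λ s → ¬? (s ∈? entriesOutsideRow A i))
                      (∈-deduplicate⁺ ℕ._≟_ (∉entriesOutsideRow⇒∈rowEntries s∈A s∉rest)) s∉rest)
  ... | yes s∈rest with r , c , r≢i , refl ← ∈-entriesOutsideRow⁻ s∈rest with ∉del⇒onRow⊎onCol s∉A′
  ...   | inj₁ r≡i  = contradiction r≡i r≢i
  ...   | inj₂ refl = ∈-++⁺ʳ (onlyInRow A i) (∈-colEntriesOutsideRow⁺ r≢i)

∈-Ψ-transpose : ∀ {n} (A : Array (suc n)) i j {s} → s ∈ Ψ A i j → s ∈ Ψ (transpose A) j i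
∈-Ψ-transpose A i j s∈ with s∈A , s∉A′ ← ∈-Ψ⁻ A i j s∈ =
  ∈-Ψ⁺ (transpose A) j i (∈-entries-transpose s∈A) (s∉A′ ∘ ∈-entries-transpose {A = transpose (del A i j)})

Ψ⊆onlyInCol++row : ∀ {n} (A : Array (suc n)) i j →
                   Ψ A i j ⊆ onlyInCol A j ++ colEntriesOutsideRow (transpose A) j i
Ψ⊆onlyInCol++row A i j =
  ++⁺ {ws = onlyInRow (transpose A) j} (onlyInRowᵀ⇒onlyInCol {A = A} {j}) id
  ∘ Ψ⊆onlyInRow++col (transpose A) j i
  ∘ ∈-Ψ-transpose A i j

length-Ψ≤length-onlyInRow+n : ∀ {n} (A : Array (suc n)) i j →
                              length (Ψ A i j) ℕ.≤ length (onlyInRow A i) ℕ.+ n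
length-Ψ≤length-onlyInRow+n A i j =
  subst (λ m → length (Ψ A i j) ℕ.≤ length (onlyInRow A i) ℕ.+ m)
        (length-colEntriesOutsideRow A i j)
    (unique∧⊆++⇒length≤ ℕ._≟_ (onlyInRow A i) (Ψ-unique A i j) (Ψ⊆onlyInRow++col A i j))

length-Ψ≤length-onlyInCol+n : ∀ {n} (A : Array (suc n)) i j →
                              length (Ψ A i j) ℕ.≤ length (onlyInCol A j) ℕ.+ n
length-Ψ≤length-onlyInCol+n A i j =
  subst (λ m → length (Ψ A i j) ℕ.≤ length (onlyInCol A j) ℕ.+ m)
        (length-colEntriesOutsideRow (transpose A) j i)
    (unique∧⊆++⇒length≤ ℕ._≟_ (onlyInCol A j) (Ψ-unique A i j) (Ψ⊆onlyInCol++row A i j))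

data PunchInView {n} (i : Fin (suc n)) : Fin (suc n) → Set where
  at        : PunchInView i i
  punchedIn : ∀ r → PunchInView i (punchIn i r)

punchInView : ∀ {n} (i r : Fin (suc n)) → PunchInView i r
punchInView i r with r Fin.≟ i
... | yes refl = at
... | no r≢i   = subst (PunchInView i) (Fin.punchIn-punchOut (r≢i ∘ sym)) (punchedIn _)

injective-viaPunchIn : ∀ {n} {X : Set} (g : Fin (suc n) → X) (i : Fin (suc n)) (h : Fin n → X) →
  (∀ r → g (punchIn i r) ≡ h r) → Injective _≡_ _≡_ h → (∀ r → h r ≢ g i) → Injective _≡_ _≡_ g
injective-viaPunchIn g i h g∘punchIn≡h h-inj h≢gi {x} {y} gx≡gy with punchInView i x | punchInView i y
... | at          | at          = refl
... | at          | punchedIn s = contradiction (trans (sym (g∘punchIn≡h s)) (sym gx≡gy)) (h≢gi s)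
... | punchedIn r | at          = contradiction (trans (sym (g∘punchIn≡h r)) gx≡gy) (h≢gi r)
... | punchedIn r | punchedIn s =
  cong (punchIn i) (h-inj (trans (sym (g∘punchIn≡h r)) (trans gx≡gy (g∘punchIn≡h s))))

module _ {n : ℕ} (i j : Fin (suc n)) (σ : Fin n → Fin n) where

  insertAt : Fin (suc n) → Fin (suc n)
  insertAt r with r Fin.≟ i
  ... | yes _  = j
  ... | no r≢i = punchIn j (σ (punchOut (r≢i ∘ sym)))

  insertAt-i : insertAt i ≡ j
  insertAt-i with i Fin.≟ i
  ... | yes _  = refl
  ... | no i≢i = contradiction refl i≢i

  insertAt-punchIn : ∀ r → insertAt (punchIn i r) ≡ punchIn j (σ r)
  insertAt-punchIn r with punchIn i r Fin.≟ i
  ... | yes eq = contradiction eq (Fin.punchInᵢ≢i i r)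
  ... | no _   = cong (punchIn j ∘ σ) (trans (Fin.punchOut-cong i refl) (Fin.punchOut-punchIn i))

∉del⇒transversal-extends : ∀ {n} (A : Array (suc n)) i j → A i j ∉ entries (del A i j) →
                           HasTransversal n (del A i j) → HasTransversal (suc n) A
∉del⇒transversal-extends A i j Aij∉ (σ , σ-inj , symbols-inj) = τ , τ-inj , τ-symbols-inj
  where
  τ = insertAt i j σ
  τ-inj : Injective _≡_ _≡_ τ
  τ-inj = injective-viaPunchIn τ i (punchIn j ∘ σ) (insertAt-punchIn i j σ)
    (σ-inj ∘ Fin.punchIn-injective j _ _)
    (λ r → subst (punchIn j (σ r) ≢_) (sym (insertAt-i i j σ)) (Fin.punchInᵢ≢i j (σ r)))
  τ-symbols-inj : Injective _≡_ _≡_ (λ r → A r (τ r))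
  τ-symbols-inj = injective-viaPunchIn (λ r → A r (τ r)) i (λ r → del A i j r (σ r))
    (λ r → cong (A (punchIn i r)) (insertAt-punchIn i j σ r))
    symbols-inj
    (λ r eq → Aij∉ (subst (_∈ entries (del A i j)) (trans eq (cong (A i) (insertAt-i i j σ)))
                    (∈-entries⁺ (del A i j) r (σ r))))

2≤occ : ∀ {n} (A : Array n) {r c r′ c′ s} → (r , c) ≢ (r′ , c′) → A r c ≡ s → A r′ c′ ≡ s → 2 ℕ.≤ occ A s
2≤occ {n} A {r} {c} {r′} {c′} {s} rc≢rc′ Arc≡s Ar′c′≡s =
  subst (2 ℕ.≤_) (sym (length-filter-map (ℕ._≟ s) (entryAt A) (cells n)))
    (≢-members⇒2≤length rc≢rc′ (∈-filter⁺ ≡s? (∈-cells r c) Arc≡s)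
                                (∈-filter⁺ ≡s? (∈-cells r′ c′) Ar′c′≡s))
  where ≡s? = λ rc → entryAt A rc ℕ.≟ s

singleton⇒∉del : ∀ {n} (A : Array (suc n)) i j → Singleton A i j → A i j ∉ entries (del A i j)
singleton⇒∉del A i j single Aij∈ with r , c , Aij≡ ← ∈-entries⁻ Aij∈ =
  ℕ.<-irrefl (sym single) (2≤occ A (Fin.punchInᵢ≢i i r ∘ cong proj₁) (sym Aij≡) refl)

del-sparse : ∀ {𝒜 α n} (A : Array (suc n)) i j → Prop-i 𝒜 → InM* 𝒜 α (suc n) A → Singleton A i j →
             ⟦ #sym (del A i j) ⟧ < α * ⟦ n ℕ.* n ⟧
del-sparse {n = n} A i j del-closed ((A∈𝒜 , no-transversal , _) , order-minimal , _) single =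
  ℚ.≰⇒> λ del-dense → ℕ.<-irrefl refl
    (order-minimal n (del A i j) (del-closed n A A∈𝒜 i j , del-no-transversal , del-dense))
  where
  del-no-transversal = no-transversal ∘ ∉del⇒transversal-extends A i j (singleton⇒∉del A i j single)

lemma8 : (𝒜 : Class) → Prop-i 𝒜 → Prop-ii 𝒜 →
    (α : ℚ) → ½ ≤ α → α ≤ 1ℚ →
    Σ ℕ (λ m → Σ (Array m) (λ B → InM 𝒜 α m B)) →
    (n : ℕ) (A : Array (suc n)) → InM* 𝒜 α (suc n) A →
    (i j : Fin (suc n)) → Singleton A i j →
    (α * (⟦ 2 Data.Nat.* suc n ⟧ - 1ℚ) < ⟦ length (Ψ A i j) ⟧)
    × ((⟦ 2 ⟧ * α - 1ℚ) * ⟦ suc n ⟧ < ⟦ length (onlyInRow A i) ⟧)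
    × ((⟦ 2 ⟧ * α - 1ℚ) * ⟦ suc n ⟧ < ⟦ length (onlyInCol A j) ⟧)
lemma8 𝒜 del-closed _ α _ α≤1 _ n A A∈M*@((_ , _ , A-dense) , _) i j single =
  many-vanish , line-gap α n α≤1 many-vanish (length-Ψ≤length-onlyInRow+n A i j)
              , line-gap α n α≤1 many-vanish (length-Ψ≤length-onlyInCol+n A i j)
  where
  many-vanish : α * (⟦ 2 ℕ.* suc n ⟧ - 1ℚ) < ⟦ length (Ψ A i j) ⟧
  many-vanish = square-gap α n {#sym A} {#sym (del A i j)} A-dense
                  (del-sparse {α = α} A i j del-closed A∈M* single)
                  (length-distinct≤ (entries A) (entries (del A i j)))
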